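{- Let $K_t(\omega)$ be a complete graph on vertex set $[t]$ whose edges have weights $\omega(i,j)\in\{\frac12,1\}$. Suppose that $K_t(\omega)$ contains $\ell_1$ copies of $C_8$, $\ell_2$ copies of $K_5$, $\ell_3$ copies of $C_5$, $\ell_4$ copies of $K_4$, $\ell_5$ copies of $C_4$, $\ell_6$ copies of $K_3$ and $\ell_7$ edges, all of these subgraphs pairwise vertex-disjoint, and such that every edge of each of these subgraphs has weight $\frac12$. Then $$2g(K_t(\omega))\le 1-\frac{30}{30t-120\ell_1-100\ell_2-75\ell_3-72\ell_4-60\ell_5-45\ell_6-20\ell_7}.$$
   Context: For a complete graph $K_t(\omega)$ on $[t]$ with edge weights $\omega(i,j)\in\{\frac12,1\}$, its edge density is $g(K_t(\omega))=\max_{\mathbf u}\sum_{1\le i<j\le t}\omega(i,j)u_iu_j$, the maximum over all vectors $\mathbf u=(u_1,\dots,u_t)$ with $u_i\ge0$ and $\sum_i u_i=1$. For copies of cycles $C_8,C_5,C_4$ only the cycle edges are required to have weight $\frac12$.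
   Formalization: The vectors $\mathbf u$ in the definition of the edge density $g$ have rational entries. -}

module Defs where

open import Data.Nat as ℕ using (ℕ; zero; suc)
open import Data.Fin as Fin using (Fin; zero; suc; toℕ; inject₁; fromℕ)
open import Data.Vec as Vec using (Vec; lookup; toList)
open import Data.List as List using (List; concat; allFin)
open import Data.List.Relation.Unary.Unique.Propositional using (Unique)
open import Data.Integer as ℤ using (ℤ; +_)
open import Data.Rational as ℚ using (ℚ; ½; 1ℚ; 0ℚ; _≤_; _*_; _+_)
open import Data.Product using (_×_)
open import Relation.Binary.PropositionalEquality using (_≡_; _≢_)
open import Relation.Nullary using (yes; no)

data Weight : Set where
  half one : Weight

val : Weight → ℚ
val half = ½
val one  = 1ℚ

-- A weighting of the edges of the complete graph on [t] (Fin t); it must be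
-- symmetric (only pairs i ≠ j matter).
Symmetric : {t : ℕ} → (Fin t → Fin t → Weight) → Set
Symmetric {t} ω = ∀ (i j : Fin t) → ω i j ≡ ω j i

∑ : (n : ℕ) → (Fin n → ℚ) → ℚ
∑ zero    f = 0ℚ
∑ (suc n) f = f zero + ∑ n (λ i → f (suc i))

InSimplex : {t : ℕ} → (Fin t → ℚ) → Set
InSimplex {t} u = (∀ i → 0ℚ ≤ u i) × (∑ t u ≡ 1ℚ)

lagr : {t : ℕ} → (Fin t → Fin t → Weight) → (Fin t → ℚ) → ℚ
lagr {t} ω u = ∑ t (λ i → ∑ t (λ j → pairTerm i j))
  where
  pairTerm : Fin t → Fin t → ℚ
  pairTerm i j with toℕ i ℕ.<? toℕ j
  ... | yes _ = val (ω i j) * (u i * u j)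
  ... | no  _ = 0ℚ

CycleHalf : {t k : ℕ} → (Fin t → Fin t → Weight) → Vec (Fin t) (suc k) → Set
CycleHalf {t} {k} ω v =
  (∀ (i : Fin k) → ω (lookup v (inject₁ i)) (lookup v (suc i)) ≡ half)
  × (ω (lookup v (fromℕ k)) (lookup v zero) ≡ half)

CliqueHalf : {t m : ℕ} → (Fin t → Fin t → Weight) → Vec (Fin t) m → Set
CliqueHalf {t} {m} ω v = ∀ (i j : Fin m) → i ≢ j → ω (lookup v i) (lookup v j) ≡ half

verts : {t m ℓ : ℕ} → Vec (Vec (Fin t) m) ℓ → List (Fin t)
verts cs = concat (List.map toList (toList cs))

denom : (t ℓ₁ ℓ₂ ℓ₃ ℓ₄ ℓ₅ ℓ₆ ℓ₇ : ℕ) → ℚ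
denom t ℓ₁ ℓ₂ ℓ₃ ℓ₄ ℓ₅ ℓ₆ ℓ₇ =
  (+ (30 ℕ.* t) ℤ.- + (120 ℕ.* ℓ₁) ℤ.- + (100 ℕ.* ℓ₂) ℤ.- + (75 ℕ.* ℓ₃)
     ℤ.- + (72 ℕ.* ℓ₄) ℤ.- + (60 ℕ.* ℓ₅) ℤ.- + (45 ℕ.* ℓ₆) ℤ.- + (20 ℕ.* ℓ₇)) ℚ./ 1

-- Fix u in the simplex and θ ∈ ℚ. For vertices a, b let d(a,a) = u_a² and d(a,b) = (1 − ω(a,b)) u_a u_b
-- for a ≠ b; then d ≥ 0 and Σ_{a,b} d(a,b) = 1 − 2L(u). The slack of a vertex, Σ_b d(a,b) − 2θu_a + θ²,
-- is at least (u_a − θ)² ≥ 0, and on the vertex set of a copy H whose edges weigh ½ the slacks add up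
-- to at least a quadratic form in (u_a)_{a ∈ H} and θ, which an explicit sum of squares bounds below by
-- c_H θ², where c_H = 4, 10/3, 5/2, 12/5, 2, 3/2, 2/3 for C₈, K₅, C₅, K₄, C₄, K₃, K₂. Summing over all
-- vertices gives 1 − 2L − 2θ + tθ² ≥ (Σ_H ℓ_H c_H) θ², that is 2L ≤ 1 − 2θ + Nθ² with
-- N = t − Σ_H ℓ_H c_H, and 30N is the denominator D of the statement; θ = 1/N yields 2L ≤ 1 − 30/D.
-- Since c_H ≤ ⅔|H| and the copies are disjoint, N ≥ t/3 > 0.

{-# OPTIONS --safe #-}
module Submission where

open import Defs
open import Data.Nat using (ℕ)
open import Data.Integer using (+_)
open import Data.Fin using (Fin)
open import Data.Vec using (Vec; lookup)
open import Data.List using (_++_)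
open import Data.List.Relation.Unary.Unique.Propositional using (Unique)
open import Data.Product using (Σ)
open import Data.Rational using (ℚ; NonZero; _÷_; _-_; _*_; _≤_; _/_; 1ℚ)

open import Data.Bool using (Bool; true; false; if_then_else_; _∨_; T)
open import Data.Bool.Properties using (T-∨)
open import Data.Empty using (⊥-elim)
open import Data.Fin using (zero; suc; toℕ; inject₁; fromℕ)
open import Data.Fin.Properties using (_≟_; toℕ-injective)
open import Data.Integer as ℤ using (ℤ)
import Data.Integer.Properties as ℤ
open import Data.List as List using (List; []; _∷_; concatMap)
open import Data.List.Properties using (++-identityʳ)
open import Data.List.Relation.Unary.All as All using (All; []; _∷_)
import Data.List.Relation.Unary.All.Properties as All
open import Data.List.Relation.Unary.AllPairs using ([]; _∷_)
open import Data.Nat as ℕ using (zero; suc)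
import Data.Nat.Properties as ℕ
open import Data.Product using (_×_; _,_; proj₁)
open import Data.Rational
  using (0ℚ; ½; _+_; -_; _<_; 1/_; Positive; toℚᵘ; nonNegative; positive)
open import Data.Rational.Properties
  using ( ≤-refl; ≤-reflexive; ≤-trans; ≤-total; _≤?_; module ≤-Reasoning
        ; +-mono-≤; +-monoˡ-≤; +-monoʳ-≤; +-mono-<-≤; +-identityˡ; +-identityʳ; +-assoc; +-inverseʳ
        ; *-identityˡ; *-identityʳ; *-zeroˡ; *-zeroʳ; *-comm; *-distribˡ-+; *-distribʳ-+; *-inverseˡ
        ; neg-distrib-+; neg-antimono-≤; nonNegative⁻¹; positive⁻¹; nonNeg*nonNeg⇒nonNeg; pos*pos⇒pos
        ; normalize-nonNeg; pos⇒nonZero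
        ; toℚᵘ-injective; toℚᵘ-fromℚᵘ; toℚᵘ-homo-+; toℚᵘ-homo-*; toℚᵘ-homo‿- )
open import Data.Rational.Solver using (module +-*-Solver)
open +-*-Solver using (Polynomial; con; var; _:+_; _:*_; _:-_; :-_; ⟦_⟧; ⟦_⟧↓; prove; solve; _:=_)
import Data.Rational.Unnormalised as ℚᵘ
import Data.Rational.Unnormalised.Properties as ℚᵘ
open import Data.Sum using (inj₁; inj₂)
open import Data.Vec using (_∷_; []; toList; tabulate)
open import Data.Vec.Properties using (lookup∘tabulate)
import Data.Vec.Relation.Unary.All.Properties as VecAll
open import Data.Vec.Relation.Unary.AllPairs using ([]; _∷_)
import Data.Vec.Relation.Unary.Unique.Propositional as Vecᵘ
import Data.Vec.Relation.Unary.Unique.Propositional.Properties as Vecᵘ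
open import Function using (_∘_; Equivalence)
open import Relation.Binary using (tri<; tri≈; tri>)
open import Relation.Binary.PropositionalEquality
open import Relation.Nullary using (yes; no; does; ¬_)
open import Relation.Nullary.Decidable using (True; toWitness; ⌊_⌋)

2ℚ : ℚ
2ℚ = + 2 / 1

p≤q⇒0≤q-p : ∀ {p q} → p ≤ q → 0ℚ ≤ q - p
p≤q⇒0≤q-p {p} {q} p≤q = subst (_≤ q - p) (+-inverseʳ p) (+-monoˡ-≤ (- p) p≤q)

0≤q-p⇒p≤q : ∀ {p q} → 0ℚ ≤ q - p → p ≤ q
0≤q-p⇒p≤q {p} {q} 0≤q-p = subst₂ _≤_ (+-identityʳ p) p+[q-p]≡q (+-monoʳ-≤ p 0≤q-p)
  where
  p+[q-p]≡q : p + (q - p) ≡ q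
  p+[q-p]≡q = solve 2 (λ p q → p :+ (q :- p) := q) refl p q

*-nonNeg : ∀ {p q} → 0ℚ ≤ p → 0ℚ ≤ q → 0ℚ ≤ p * q
*-nonNeg {p} {q} 0≤p 0≤q =
  nonNegative⁻¹ (p * q) {{nonNeg*nonNeg⇒nonNeg p {{nonNegative 0≤p}} q {{nonNegative 0≤q}}}}

square-nonNeg : ∀ p → 0ℚ ≤ p * p
square-nonNeg p with ≤-total 0ℚ p
... | inj₁ 0≤p = *-nonNeg 0≤p 0≤p
... | inj₂ p≤0 = subst (0ℚ ≤_) [-p]*[-p]≡p*p (*-nonNeg 0≤-p 0≤-p)
  where
  0≤-p : 0ℚ ≤ - p
  0≤-p = neg-antimono-≤ p≤0
  [-p]*[-p]≡p*p : - p * - p ≡ p * p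
  [-p]*[-p]≡p*p = solve 1 (λ p → (:- p) :* (:- p) := p :* p) refl p

/-nonNeg : ∀ m n .{{_ : ℕ.NonZero n}} → 0ℚ ≤ + m / n
/-nonNeg m n = nonNegative⁻¹ (+ m / n) {{normalize-nonNeg m n}}

≤-by-computation : ∀ {p q} → True (p ≤? q) → p ≤ q
≤-by-computation = toWitness

ι : ℤ → ℚ
ι z = z / 1

toℚᵘ-ι : ∀ z → toℚᵘ (ι z) ℚᵘ.≃ ℚᵘ.mkℚᵘ z 0
toℚᵘ-ι z = toℚᵘ-fromℚᵘ (ℚᵘ.mkℚᵘ z 0)

ι-+ : ∀ a b → ι (a ℤ.+ b) ≡ ι a + ι b
ι-+ a b = toℚᵘ-injective (begin
  toℚᵘ (ι (a ℤ.+ b))               ≈⟨ toℚᵘ-ι (a ℤ.+ b) ⟩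
  ℚᵘ.mkℚᵘ (a ℤ.+ b) 0              ≈⟨ ℚᵘ.*≡* (cong (ℤ._* + 1)
                                         (cong₂ ℤ._+_ (ℤ.*-identityʳ a) (ℤ.*-identityʳ b))) ⟨
  ℚᵘ.mkℚᵘ a 0 ℚᵘ.+ ℚᵘ.mkℚᵘ b 0     ≈⟨ ℚᵘ.+-cong (toℚᵘ-ι a) (toℚᵘ-ι b) ⟨
  toℚᵘ (ι a) ℚᵘ.+ toℚᵘ (ι b)       ≈⟨ toℚᵘ-homo-+ (ι a) (ι b) ⟨
  toℚᵘ (ι a + ι b)                 ∎)
  where open ℚᵘ.≃-Reasoning

ι-* : ∀ a b → ι (a ℤ.* b) ≡ ι a * ι b
ι-* a b = toℚᵘ-injective (begin
  toℚᵘ (ι (a ℤ.* b))               ≈⟨ toℚᵘ-ι (a ℤ.* b) ⟩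
  ℚᵘ.mkℚᵘ (a ℤ.* b) 0              ≈⟨ ℚᵘ.*-cong (toℚᵘ-ι a) (toℚᵘ-ι b) ⟨
  toℚᵘ (ι a) ℚᵘ.* toℚᵘ (ι b)       ≈⟨ toℚᵘ-homo-* (ι a) (ι b) ⟨
  toℚᵘ (ι a * ι b)                 ∎)
  where open ℚᵘ.≃-Reasoning

ι-neg : ∀ a → ι (ℤ.- a) ≡ - ι a
ι-neg a = toℚᵘ-injective (begin
  toℚᵘ (ι (ℤ.- a))                 ≈⟨ toℚᵘ-ι (ℤ.- a) ⟩
  ℚᵘ.- ℚᵘ.mkℚᵘ a 0                 ≈⟨ ℚᵘ.-‿cong (toℚᵘ-ι a) ⟨
  ℚᵘ.- toℚᵘ (ι a)                  ≈⟨ toℚᵘ-homo‿- (ι a) ⟨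
  toℚᵘ (- ι a)                     ∎)
  where open ℚᵘ.≃-Reasoning

ι-- : ∀ a b → ι (a ℤ.- b) ≡ ι a - ι b
ι-- a b = trans (ι-+ a (ℤ.- b)) (cong (_+_ (ι a)) (ι-neg b))

ι-suc : ∀ n → ι (+ suc n) ≡ 1ℚ + ι (+ n)
ι-suc n = ι-+ (+ 1) (+ n)

ι-nonNeg : ∀ n → 0ℚ ≤ ι (+ n)
ι-nonNeg n = /-nonNeg n 1

1≤ι : ∀ {n} → 1 ℕ.≤ n → 1ℚ ≤ ι (+ n)
1≤ι {suc n} _ = subst₂ _≤_ (+-identityʳ 1ℚ) (sym (ι-suc n)) (+-monoʳ-≤ 1ℚ (ι-nonNeg n))

∑-cong : ∀ n {f g : Fin n → ℚ} → (∀ i → f i ≡ g i) → ∑ n f ≡ ∑ n g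
∑-cong zero    f≡g = refl
∑-cong (suc n) f≡g = cong₂ _+_ (f≡g zero) (∑-cong n (f≡g ∘ suc))

∑-+ : ∀ n (f g : Fin n → ℚ) → ∑ n (λ i → f i + g i) ≡ ∑ n f + ∑ n g
∑-+ zero    f g = refl
∑-+ (suc n) f g = trans (cong (_+_ (f zero + g zero)) (∑-+ n (f ∘ suc) (g ∘ suc)))
  (solve 4 (λ a b c d → (a :+ b) :+ (c :+ d) := (a :+ c) :+ (b :+ d)) refl
    (f zero) (g zero) (∑ n (f ∘ suc)) (∑ n (g ∘ suc)))

∑-neg : ∀ n (f : Fin n → ℚ) → ∑ n (λ i → - f i) ≡ - ∑ n f
∑-neg zero    f = refl
∑-neg (suc n) f = trans (cong (_+_ (- f zero)) (∑-neg n (f ∘ suc))) (sym (neg-distrib-+ (f zero) _))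

∑-- : ∀ n (f g : Fin n → ℚ) → ∑ n (λ i → f i - g i) ≡ ∑ n f - ∑ n g
∑-- n f g = trans (∑-+ n f (λ i → - g i)) (cong (_+_ (∑ n f)) (∑-neg n g))

∑-*ˡ : ∀ n c (f : Fin n → ℚ) → ∑ n (λ i → c * f i) ≡ c * ∑ n f
∑-*ˡ zero    c f = sym (*-zeroʳ c)
∑-*ˡ (suc n) c f = trans (cong (_+_ (c * f zero)) (∑-*ˡ n c (f ∘ suc))) (sym (*-distribˡ-+ c (f zero) _))

∑-zero : ∀ n → ∑ n (λ _ → 0ℚ) ≡ 0ℚ
∑-zero zero    = refl
∑-zero (suc n) = trans (+-identityˡ _) (∑-zero n)

∑-swap : ∀ n m (f : Fin n → Fin m → ℚ) → ∑ n (λ i → ∑ m (f i)) ≡ ∑ m (λ j → ∑ n (λ i → f i j))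
∑-swap zero    m f = sym (∑-zero m)
∑-swap (suc n) m f = trans (cong (_+_ (∑ m (f zero))) (∑-swap n m (f ∘ suc))) (sym (∑-+ m _ _))

∑-const : ∀ n c → ∑ n (λ _ → c) ≡ ι (+ n) * c
∑-const zero    c = sym (*-zeroˡ c)
∑-const (suc n) c = begin
  c + ∑ n (λ _ → c)     ≡⟨ cong (_+_ c) (∑-const n c) ⟩
  c + ι (+ n) * c       ≡⟨ solve 2 (λ c x → c :+ x :* c := (con 1ℚ :+ x) :* c) refl c (ι (+ n)) ⟩
  (1ℚ + ι (+ n)) * c    ≡⟨ cong (_* c) (ι-suc n) ⟨
  ι (+ suc n) * c       ∎
  where open ≡-Reasoning

∑-mono : ∀ n {f g : Fin n → ℚ} → (∀ i → f i ≤ g i) → ∑ n f ≤ ∑ n g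
∑-mono zero    f≤g = ≤-refl
∑-mono (suc n) f≤g = +-mono-≤ (f≤g zero) (∑-mono n (f≤g ∘ suc))

∑-nonNeg : ∀ n {f : Fin n → ℚ} → (∀ i → 0ℚ ≤ f i) → 0ℚ ≤ ∑ n f
∑-nonNeg n {f} 0≤f = subst (_≤ ∑ n f) (∑-zero n) (∑-mono n 0≤f)

erase : ∀ {n} → Fin n → (Fin n → ℚ) → Fin n → ℚ
erase x f i = if does (x ≟ i) then 0ℚ else f i

erase-nonNeg : ∀ {n} x {f : Fin n → ℚ} → (∀ i → 0ℚ ≤ f i) → ∀ i → 0ℚ ≤ erase x f i
erase-nonNeg x 0≤f i with x ≟ i
... | yes _ = ≤-refl
... | no  _ = 0≤f i

∑-erase : ∀ n x (f : Fin n → ℚ) → ∑ n f ≡ f x + ∑ n (erase x f)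
∑-erase (suc n) zero    f = cong (_+_ (f zero)) (sym (+-identityˡ _))
∑-erase (suc n) (suc x) f = trans (cong (_+_ (f zero)) (∑-erase n x (f ∘ suc)))
  (solve 3 (λ a b c → a :+ (b :+ c) := b :+ (a :+ c)) refl (f zero) (f (suc x)) _)

∑ᴸ : ∀ {A : Set} → (A → ℚ) → List A → ℚ
∑ᴸ f = List.foldr (λ x s → f x + s) 0ℚ

∑ᴸ-++ : ∀ {A : Set} (f : A → ℚ) xs ys → ∑ᴸ f (xs ++ ys) ≡ ∑ᴸ f xs + ∑ᴸ f ys
∑ᴸ-++ f []       ys = sym (+-identityˡ _)
∑ᴸ-++ f (x ∷ xs) ys = trans (cong (_+_ (f x)) (∑ᴸ-++ f xs ys)) (sym (+-assoc (f x) _ _))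

∑ᴸ-toList : ∀ {A : Set} {k} (f : A → ℚ) (v : Vec A k) → ∑ᴸ f (toList v) ≡ ∑ k (f ∘ lookup v)
∑ᴸ-toList f []      = refl
∑ᴸ-toList f (x ∷ v) = cong (_+_ (f x)) (∑ᴸ-toList f v)

∑ᴸ-erase : ∀ {n} {x} (f : Fin n → ℚ) {xs} → All (x ≢_) xs → ∑ᴸ (erase x f) xs ≡ ∑ᴸ f xs
∑ᴸ-erase f []                 = refl
∑ᴸ-erase {x = x} f {y ∷ _} (x≢y ∷ x∉xs) with x ≟ y
... | yes x≡y = ⊥-elim (x≢y x≡y)
... | no  _   = cong (_+_ (f y)) (∑ᴸ-erase f x∉xs)

∑ᴸ≤∑ : ∀ {n} {f : Fin n → ℚ} → (∀ i → 0ℚ ≤ f i) → ∀ {xs} → Unique xs → ∑ᴸ f xs ≤ ∑ n f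
∑ᴸ≤∑ {n} 0≤f {[]} [] = ∑-nonNeg n 0≤f
∑ᴸ≤∑ {n} {f} 0≤f {x ∷ xs} (x∉xs ∷ unique) = begin
  f x + ∑ᴸ f xs              ≡⟨ cong (_+_ (f x)) (∑ᴸ-erase f x∉xs) ⟨
  f x + ∑ᴸ (erase x f) xs    ≤⟨ +-monoʳ-≤ (f x) (∑ᴸ≤∑ (erase-nonNeg x 0≤f) unique) ⟩
  f x + ∑ n (erase x f)      ≡⟨ ∑-erase n x f ⟨
  ∑ n f                      ∎
  where open ≤-Reasoning

-- Quadratic forms of graphs and their sum-of-squares bounds

weight : ∀ {k} → (Fin k → Fin k → Bool) → Fin k → Fin k → ℚ
weight adj i j = if does (i ≟ j) then 1ℚ else if adj i j then ½ else 0ℚ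

energy : ∀ {k} → (Fin k → Fin k → Bool) → (Fin k → ℚ) → ℚ → ℚ
energy {k} adj x m = ∑ k λ i → ∑ k (λ j → weight adj i j * (x i * x j)) - 2ℚ * m * x i + m * m

energy-cong : ∀ {k} adj {x y : Fin k → ℚ} m → (∀ i → x i ≡ y i) → energy adj x m ≡ energy adj y m
energy-cong {k} adj m x≡y = ∑-cong k λ i → cong₂ (λ s xᵢ → s - 2ℚ * m * xᵢ + m * m)
  (∑-cong k λ j → cong (_*_ (weight adj i j)) (cong₂ _*_ (x≡y i) (x≡y j))) (x≡y i)

∑ᴾ : ∀ {m} n → (Fin n → Polynomial m) → Polynomial m
∑ᴾ zero    f = con 0ℚ
∑ᴾ (suc n) f = f zero :+ ∑ᴾ n (f ∘ suc)

⟦∑ᴾ⟧ : ∀ {m} n (f : Fin n → Polynomial m) ρ → ⟦ ∑ᴾ n f ⟧ ρ ≡ ∑ n (λ i → ⟦ f i ⟧ ρ)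
⟦∑ᴾ⟧ zero    f ρ = refl
⟦∑ᴾ⟧ (suc n) f ρ = cong (_+_ (⟦ f zero ⟧ ρ)) (⟦∑ᴾ⟧ n (f ∘ suc) ρ)

M : ∀ {k} → Polynomial (suc k)
M = var zero

X : ∀ {k} → Fin k → Polynomial (suc k)
X i = var (suc i)

-- energy, written in the solver's syntax over the variables m, x₀, …, x_{k-1} (in this order).
energyᴾ : ∀ {k} → (Fin k → Fin k → Bool) → Polynomial (suc k)
energyᴾ {k} adj = ∑ᴾ k λ i → ∑ᴾ k (λ j → con (weight adj i j) :* (X i :* X j)) :- con 2ℚ :* M :* X i :+ M :* M

⟦energyᴾ⟧ : ∀ {k} adj m (xs : Vec ℚ k) → ⟦ energyᴾ adj ⟧ (m ∷ xs) ≡ energy adj (lookup xs) m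
⟦energyᴾ⟧ {k} adj m xs = trans (⟦∑ᴾ⟧ k _ (m ∷ xs)) (∑-cong k λ i →
  cong (λ s → s - 2ℚ * m * lookup xs i + m * m) (⟦∑ᴾ⟧ k _ (m ∷ xs)))

sumOfSquares : ∀ {n} → List (ℚ × Polynomial n) → Polynomial n
sumOfSquares []             = con 0ℚ
sumOfSquares ((w , p) ∷ ps) = con w :* (p :* p) :+ sumOfSquares ps

sumOfSquares-nonNeg : ∀ {n} {ps : List (ℚ × Polynomial n)} → All (λ wp → 0ℚ ≤ proj₁ wp) ps →
                      ∀ ρ → 0ℚ ≤ ⟦ sumOfSquares ps ⟧ ρ
sumOfSquares-nonNeg []                                ρ = ≤-refl
sumOfSquares-nonNeg {ps = (w , p) ∷ _} (0≤w ∷ 0≤ws) ρ =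
  +-mono-≤ (*-nonNeg 0≤w (square-nonNeg (⟦ p ⟧ ρ))) (sumOfSquares-nonNeg 0≤ws ρ)

-- Stated on normal forms, so that for each concrete order it is proved by refl.
SOSIdentity : ∀ {k} → (Fin k → Fin k → Bool) → ℚ → List (ℚ × Polynomial (suc k)) → Set
SOSIdentity adj c ps = ∀ ρ → ⟦ energyᴾ adj :- con c :* (M :* M) ⟧↓ ρ ≡ ⟦ sumOfSquares ps ⟧↓ ρ

energy-bound : ∀ {k} adj c (ps : List (ℚ × Polynomial (suc k))) → All (λ wp → 0ℚ ≤ proj₁ wp) ps →
               SOSIdentity adj c ps → ∀ x m → c * (m * m) ≤ energy adj x m
energy-bound adj c ps 0≤ws sos x m = 0≤q-p⇒p≤q (begin
  0ℚ                                                ≤⟨ sumOfSquares-nonNeg 0≤ws ρ ⟩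
  ⟦ sumOfSquares ps ⟧ ρ                             ≡⟨ prove ρ (energyᴾ adj :- con c :* (M :* M)) (sumOfSquares ps)
                                                               (sos ρ) ⟨
  ⟦ energyᴾ adj ⟧ ρ - c * (m * m)                   ≡⟨ cong (_- c * (m * m)) (⟦energyᴾ⟧ adj m (tabulate x)) ⟩
  energy adj (lookup (tabulate x)) m - c * (m * m)  ≡⟨ cong (_- c * (m * m)) (energy-cong adj m (lookup∘tabulate x)) ⟩
  energy adj x m - c * (m * m)                      ∎)
  where
  open ≤-Reasoning
  ρ : Vec ℚ _
  ρ = m ∷ tabulate x

data CycleView {k : ℕ} : Fin (suc k) → Set where
  inner : (i : Fin k) → CycleView (inject₁ i)
  last  : CycleView (fromℕ k)

cycleView : ∀ {k} (i : Fin (suc k)) → CycleView i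
cycleView {zero}  zero    = last
cycleView {suc k} zero    = inner zero
cycleView {suc k} (suc i) with cycleView i
... | inner j = inner (suc j)
... | last    = last

cycleSucc : ∀ {k} → Fin (suc k) → Fin (suc k)
cycleSucc i with cycleView i
... | inner j = suc j
... | last    = zero

cycleAdj : ∀ {k} → Fin (suc k) → Fin (suc k) → Bool
cycleAdj i j = ⌊ j ≟ cycleSucc i ⌋ ∨ ⌊ i ≟ cycleSucc j ⌋

cycleDensity : ℕ → ℚ
cycleDensity n = + n / 2

cycleSquares : ∀ k → List (ℚ × Polynomial (suc (suc k)))
cycleSquares k = List.map (λ i → ½ , X i :+ X (cycleSucc i) :- M) (List.allFin (suc k))

cycle-bound : ∀ {k} → SOSIdentity cycleAdj (cycleDensity (suc k)) (cycleSquares k) →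
              ∀ x m → cycleDensity (suc k) * (m * m) ≤ energy cycleAdj x m
cycle-bound {k} = energy-bound cycleAdj _ (cycleSquares k)
  (All.map⁺ (All.universal (λ _ → /-nonNeg 1 2) (List.allFin (suc k))))

cliqueAdj : ∀ {k} → Fin k → Fin k → Bool
cliqueAdj _ _ = true

cliqueDensity : ℕ → ℚ
cliqueDensity k = + (k ℕ.* (k ℕ.∸ 1)) / suc k

cliqueSquares : ∀ k .{{_ : ℕ.NonZero k}} → List (ℚ × Polynomial (suc k))
cliqueSquares k = (½ * (+ suc k / k) , S :- con (+ (2 ℕ.* k) / suc k) :* M)
                ∷ List.map (λ i → ½ , X i :- con (+ 1 / k) :* S) (List.allFin k)
  where
  S : Polynomial (suc k)
  S = ∑ᴾ k X

clique-bound : ∀ {k} .{{_ : ℕ.NonZero k}} → SOSIdentity cliqueAdj (cliqueDensity k) (cliqueSquares k) →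
               ∀ x m → cliqueDensity k * (m * m) ≤ energy cliqueAdj x m
clique-bound {k} = energy-bound cliqueAdj _ (cliqueSquares k)
  (*-nonNeg (/-nonNeg 1 2) (/-nonNeg (suc k) k) ∷ All.map⁺ (All.universal (λ _ → /-nonNeg 1 2) (List.allFin k)))

data Shape : Set where
  C₈ K₅ C₅ K₄ C₄ K₃ K₂ : Shape

shapes : List Shape
shapes = C₈ ∷ K₅ ∷ C₅ ∷ K₄ ∷ C₄ ∷ K₃ ∷ K₂ ∷ []

order : Shape → ℕ
order C₈ = 8
order K₅ = 5
order C₅ = 5
order K₄ = 4
order C₄ = 4
order K₃ = 3
order K₂ = 2

adjacent : (s : Shape) → Fin (order s) → Fin (order s) → Bool
adjacent C₈ = cycleAdj
adjacent K₅ = cliqueAdj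
adjacent C₅ = cycleAdj
adjacent K₄ = cliqueAdj
adjacent C₄ = cycleAdj
adjacent K₃ = cliqueAdj
adjacent K₂ = cliqueAdj

density : Shape → ℚ
density C₈ = cycleDensity 8
density K₅ = cliqueDensity 5
density C₅ = cycleDensity 5
density K₄ = cliqueDensity 4
density C₄ = cycleDensity 4
density K₃ = cliqueDensity 3
density K₂ = cliqueDensity 2

shape-energy-bound : ∀ s x m → density s * (m * m) ≤ energy (adjacent s) x m
shape-energy-bound C₈ = cycle-bound (λ _ → refl)
shape-energy-bound K₅ = clique-bound (λ _ → refl)
shape-energy-bound C₅ = cycle-bound (λ _ → refl)
shape-energy-bound K₄ = clique-bound (λ _ → refl)
shape-energy-bound C₄ = cycle-bound (λ _ → refl)
shape-energy-bound K₃ = clique-bound (λ _ → refl)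
shape-energy-bound K₂ = clique-bound (λ _ → refl)

density≤⅔order : ∀ s → density s ≤ ι (+ order s) * (+ 2 / 3)
density≤⅔order C₈ = ≤-by-computation _
density≤⅔order K₅ = ≤-by-computation _
density≤⅔order C₅ = ≤-by-computation _
density≤⅔order K₄ = ≤-by-computation _
density≤⅔order C₄ = ≤-by-computation _
density≤⅔order K₃ = ≤-by-computation _
density≤⅔order K₂ = ≤-by-computation _

-- Packings of half-weighted copies

record Realizes {t k} (ω : Fin t → Fin t → Weight) (adj : Fin k → Fin k → Bool) (v : Vec (Fin t) k) : Set where
  constructor realizes
  field edge-half : ∀ i j → i ≢ j → T (adj i j) → ω (lookup v i) (lookup v j) ≡ half

module _ {t : ℕ} {ω : Fin t → Fin t → Weight} where

  cycleSucc-half : ∀ {k} {v : Vec (Fin t) (suc k)} → CycleHalf ω v →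
                   ∀ i → ω (lookup v i) (lookup v (cycleSucc i)) ≡ half
  cycleSucc-half (consecutive , closing) i with cycleView i
  ... | inner j = consecutive j
  ... | last    = closing

  cycle-realizes : ∀ {k} {v : Vec (Fin t) (suc k)} → Symmetric ω → CycleHalf ω v → Realizes ω cycleAdj v
  cycle-realizes {v = v} symω halves = realizes edge-half
    where
    edge-half : ∀ i j → i ≢ j → T (cycleAdj i j) → ω (lookup v i) (lookup v j) ≡ half
    edge-half i j _ adj with Equivalence.to (T-∨ {⌊ j ≟ cycleSucc i ⌋}) adj
    ... | inj₁ j≡succ = subst (λ j → ω (lookup v i) (lookup v j) ≡ half) (sym (toWitness j≡succ))
                              (cycleSucc-half {v = v} halves i)
    ... | inj₂ i≡succ = trans (symω _ _) (subst (λ i → ω (lookup v j) (lookup v i) ≡ half) (sym (toWitness i≡succ))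
                                                (cycleSucc-half {v = v} halves j))

  clique-realizes : ∀ {k} {v : Vec (Fin t) k} → CliqueHalf ω v → Realizes ω cliqueAdj v
  clique-realizes halves = realizes λ i j i≢j _ → halves i j i≢j

Unique-++⁻ : ∀ {A : Set} (xs : List A) {ys} → Unique (xs ++ ys) → Unique xs × Unique ys
Unique-++⁻ []       unique                 = [] , unique
Unique-++⁻ (x ∷ xs) (x∉xs++ys ∷ unique) with Unique-++⁻ xs unique
... | unique-xs , unique-ys = (All.++⁻ˡ xs x∉xs++ys ∷ unique-xs) , unique-ys

toList-unique⁻ : ∀ {A : Set} {k} {v : Vec A k} → Unique (toList v) → Vecᵘ.Unique v
toList-unique⁻ {v = []}    []             = []
toList-unique⁻ {v = x ∷ v} (x∉v ∷ unique) = VecAll.toList⁻ x∉v ∷ toList-unique⁻ unique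

module _ {t : ℕ} (ω : Fin t → Fin t → Weight) where

  record Family (s : Shape) : Set where
    constructor family
    field
      {count}  : ℕ
      copies   : Vec (Vec (Fin t) (order s)) count
      realized : ∀ a → Realizes ω (adjacent s) (lookup copies a)

  Packing : Set
  Packing = (s : Shape) → Family s

  verticesOf : Packing → List Shape → List (Fin t)
  verticesOf P = concatMap (λ s → verts (Family.copies (P s)))

  weightOf : Packing → List Shape → ℚ
  weightOf P = ∑ᴸ (λ s → ι (+ Family.count (P s)) * density s)

  packingVertices : Packing → List (Fin t)
  packingVertices P = verticesOf P shapes

  packingWeight : Packing → ℚ
  packingWeight P = weightOf P shapes

  CopyBound : (Fin t → ℚ) → ℚ → Set
  CopyBound f μ = ∀ s {v : Vec (Fin t) (order s)} → Realizes ω (adjacent s) v → Unique (toList v) →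
                  density s * μ ≤ ∑ᴸ f (toList v)

  family-bound : ∀ f μ → CopyBound f μ → ∀ s {ℓ} (cs : Vec (Vec (Fin t) (order s)) ℓ) →
                 (∀ a → Realizes ω (adjacent s) (lookup cs a)) → Unique (verts cs) →
                 ι (+ ℓ) * density s * μ ≤ ∑ᴸ f (verts cs)
  family-bound f μ bound s []       _        _      =
    ≤-reflexive (trans (cong (_* μ) (*-zeroˡ (density s))) (*-zeroˡ μ))
  family-bound f μ bound s {suc ℓ} (v ∷ cs) realized unique with Unique-++⁻ (toList v) unique
  ... | unique-v , unique-cs = begin
    ι (+ suc ℓ) * density s * μ                ≡⟨ cong (λ n → n * density s * μ) (ι-suc ℓ) ⟩
    (1ℚ + ι (+ ℓ)) * density s * μ             ≡⟨ solve 3 (λ n d μ → (con 1ℚ :+ n) :* d :* μ := d :* μ :+ n :* d :* μ)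
                                                    refl (ι (+ ℓ)) (density s) μ ⟩
    density s * μ + ι (+ ℓ) * density s * μ    ≤⟨ +-mono-≤ (bound s (realized zero) unique-v)
                                                           (family-bound f μ bound s cs (realized ∘ suc) unique-cs) ⟩
    ∑ᴸ f (toList v) + ∑ᴸ f (verts cs)          ≡⟨ ∑ᴸ-++ f (toList v) (verts cs) ⟨
    ∑ᴸ f (verts (v ∷ cs))                      ∎
    where open ≤-Reasoning

  weightOf-bound : ∀ f μ → CopyBound f μ → (P : Packing) → ∀ ss → Unique (verticesOf P ss) →
                   weightOf P ss * μ ≤ ∑ᴸ f (verticesOf P ss)
  weightOf-bound f μ bound P []       _      = ≤-reflexive (*-zeroˡ μ)
  weightOf-bound f μ bound P (s ∷ ss) unique with Unique-++⁻ (verts (Family.copies (P s))) unique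
  ... | unique-s , unique-ss = begin
    (ι (+ count) * density s + weightOf P ss) * μ      ≡⟨ *-distribʳ-+ μ (ι (+ count) * density s) _ ⟩
    ι (+ count) * density s * μ + weightOf P ss * μ    ≤⟨ +-mono-≤ (family-bound f μ bound s copies realized unique-s)
                                                                   (weightOf-bound f μ bound P ss unique-ss) ⟩
    ∑ᴸ f (verts copies) + ∑ᴸ f (verticesOf P ss)       ≡⟨ ∑ᴸ-++ f (verts copies) (verticesOf P ss) ⟨
    ∑ᴸ f (verticesOf P (s ∷ ss))                       ∎
    where
    open ≤-Reasoning
    open Family (P s)

  packing-bound : ∀ f μ → CopyBound f μ → (∀ a → 0ℚ ≤ f a) → (P : Packing) → Unique (packingVertices P) →
                  packingWeight P * μ ≤ ∑ t f
  packing-bound f μ bound 0≤f P unique = ≤-trans (weightOf-bound f μ bound P shapes unique) (∑ᴸ≤∑ 0≤f unique)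

  packingWeight≤⅔t : (P : Packing) → Unique (packingVertices P) → packingWeight P ≤ ι (+ t) * (+ 2 / 3)
  packingWeight≤⅔t P unique = begin
    packingWeight P                 ≡⟨ *-identityʳ (packingWeight P) ⟨
    packingWeight P * 1ℚ            ≤⟨ packing-bound (λ _ → + 2 / 3) 1ℚ ⅔-per-vertex (λ _ → /-nonNeg 2 3) P unique ⟩
    ∑ t (λ _ → + 2 / 3)             ≡⟨ ∑-const t (+ 2 / 3) ⟩
    ι (+ t) * (+ 2 / 3)             ∎
    where
    open ≤-Reasoning
    ⅔-per-vertex : CopyBound (λ _ → + 2 / 3) 1ℚ
    ⅔-per-vertex s {v} _ _ = begin
      density s * 1ℚ                  ≡⟨ *-identityʳ (density s) ⟩
      density s                       ≤⟨ density≤⅔order s ⟩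
      ι (+ order s) * (+ 2 / 3)       ≡⟨ trans (∑ᴸ-toList _ v) (∑-const (order s) (+ 2 / 3)) ⟨
      ∑ᴸ (λ _ → + 2 / 3) (toList v)   ∎

-- The Lagrangian

module Lagrangian {t : ℕ} (ω : Fin t → Fin t → Weight) (symω : Symmetric ω)
                  (u : Fin t → ℚ) (0≤u : ∀ a → 0ℚ ≤ u a) where

  -- The summand of lagr is local to its definition; unification recovers it.
  private
    summand : Σ (Fin t → Fin t → ℚ) λ P → lagr ω u ≡ ∑ t (λ a → ∑ t (P a))
    summand = _ , refl

  pairTerm : Fin t → Fin t → ℚ
  pairTerm = proj₁ summand

  pairTerm-< : ∀ {a b} → toℕ a ℕ.< toℕ b → pairTerm a b ≡ val (ω a b) * (u a * u b)
  pairTerm-< {a} {b} a<b with toℕ a ℕ.<? toℕ b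
  ... | yes _   = refl
  ... | no  a≮b = ⊥-elim (a≮b a<b)

  pairTerm-≮ : ∀ {a b} → ¬ toℕ a ℕ.< toℕ b → pairTerm a b ≡ 0ℚ
  pairTerm-≮ {a} {b} a≮b with toℕ a ℕ.<? toℕ b
  ... | yes a<b = ⊥-elim (a≮b a<b)
  ... | no  _   = refl

  coupling : Fin t → Fin t → ℚ
  coupling a b = pairTerm a b + pairTerm b a

  coupling-diag : ∀ a → coupling a a ≡ 0ℚ
  coupling-diag a rewrite pairTerm-≮ (ℕ.n≮n (toℕ a)) = refl

  coupling-off : ∀ {a b} → a ≢ b → coupling a b ≡ val (ω a b) * (u a * u b)
  coupling-off {a} {b} a≢b with ℕ.<-cmp (toℕ a) (toℕ b)
  ... | tri< a<b _ _ rewrite pairTerm-< a<b | pairTerm-≮ (ℕ.<⇒≯ a<b) = +-identityʳ _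
  ... | tri≈ _ a≡b _ = ⊥-elim (a≢b (toℕ-injective a≡b))
  ... | tri> _ _ b<a rewrite pairTerm-≮ (ℕ.<⇒≯ b<a) | pairTerm-< b<a | symω b a =
    trans (+-identityˡ _) (cong (_*_ (val (ω a b))) (*-comm (u b) (u a)))

  defect : Fin t → Fin t → ℚ
  defect a b = u a * u b - coupling a b

  defect-diag : ∀ a → defect a a ≡ u a * u a
  defect-diag a rewrite coupling-diag a = solve 1 (λ x → x :- con 0ℚ := x) refl (u a * u a)

  defect-off : ∀ {a b} → a ≢ b → defect a b ≡ (1ℚ - val (ω a b)) * (u a * u b)
  defect-off {a} {b} a≢b rewrite coupling-off a≢b =
    solve 2 (λ w x → x :- w :* x := (con 1ℚ :- w) :* x) refl (val (ω a b)) (u a * u b)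

  defect-half : ∀ {a b} → a ≢ b → ω a b ≡ half → defect a b ≡ ½ * (u a * u b)
  defect-half {a} {b} a≢b ωab≡half = trans (defect-off a≢b) (cong (λ w → (1ℚ - val w) * (u a * u b)) ωab≡half)

  defect-nonNeg : ∀ a b → 0ℚ ≤ defect a b
  defect-nonNeg a b with a ≟ b
  ... | yes refl = subst (0ℚ ≤_) (sym (defect-diag a)) (square-nonNeg (u a))
  ... | no  a≢b  = subst (0ℚ ≤_) (sym (defect-off a≢b)) (*-nonNeg (0≤1-val (ω a b)) (*-nonNeg (0≤u a) (0≤u b)))
    where
    0≤1-val : ∀ w → 0ℚ ≤ 1ℚ - val w
    0≤1-val half = ≤-by-computation _
    0≤1-val one  = ≤-by-computation _

  rowDefect : Fin t → ℚ
  rowDefect a = ∑ t (defect a)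

  slack : ℚ → Fin t → ℚ
  slack θ a = rowDefect a - 2ℚ * θ * u a + θ * θ

  slack-nonNeg : ∀ θ a → 0ℚ ≤ slack θ a
  slack-nonNeg θ a = begin
    0ℚ                                              ≤⟨ square-nonNeg (u a - θ) ⟩
    (u a - θ) * (u a - θ)                           ≡⟨ solve 2 (λ x θ → (x :- θ) :* (x :- θ)
                                                        := x :* x :+ con 0ℚ :- con 2ℚ :* θ :* x :+ θ :* θ) refl (u a) θ ⟩
    u a * u a + 0ℚ - 2ℚ * θ * u a + θ * θ           ≡⟨ cong (λ d → d + 0ℚ - 2ℚ * θ * u a + θ * θ) (defect-diag a) ⟨
    ∑ᴸ (defect a) (a ∷ []) - 2ℚ * θ * u a + θ * θ   ≤⟨ +-monoˡ-≤ (θ * θ) (+-monoˡ-≤ (- (2ℚ * θ * u a))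
                                                                              (∑ᴸ≤∑ (defect-nonNeg a) ([] ∷ []))) ⟩
    slack θ a                                       ∎
    where open ≤-Reasoning

  weight≤defect : ∀ {k adj} {v : Vec (Fin t) k} → Vecᵘ.Unique v → Realizes ω adj v →
    ∀ i j → weight adj i j * (u (lookup v i) * u (lookup v j)) ≤ defect (lookup v i) (lookup v j)
  weight≤defect {adj = adj} {v} unique (realizes edge-half) i j with i ≟ j
  ... | yes refl = ≤-reflexive (trans (*-identityˡ _) (sym (defect-diag (lookup v i))))
  ... | no  i≢j with adj i j in adjᵢⱼ
  ...   | true  = ≤-reflexive (sym (defect-half (i≢j ∘ Vecᵘ.lookup-injective unique i j)
                                               (edge-half i j i≢j (subst T (sym adjᵢⱼ) _))))
  ...   | false = subst (_≤ defect (lookup v i) (lookup v j)) (sym (*-zeroˡ (u (lookup v i) * u (lookup v j))))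
                        (defect-nonNeg _ _)

  energy≤∑slack : ∀ {k adj} {v : Vec (Fin t) k} → Unique (toList v) → Realizes ω adj v →
                  ∀ θ → energy adj (u ∘ lookup v) θ ≤ ∑ᴸ (slack θ) (toList v)
  energy≤∑slack {k} {adj} {v} unique realized θ = begin
    energy adj (u ∘ lookup v) θ
      ≤⟨ ∑-mono k (λ i → +-monoˡ-≤ (θ * θ) (+-monoˡ-≤ (- (2ℚ * θ * u (lookup v i))) (row≤rowDefect i))) ⟩
    ∑ k (slack θ ∘ lookup v)        ≡⟨ ∑ᴸ-toList (slack θ) v ⟨
    ∑ᴸ (slack θ) (toList v)         ∎
    where
    open ≤-Reasoning
    row≤rowDefect : ∀ i → ∑ k (λ j → weight adj i j * (u (lookup v i) * u (lookup v j))) ≤ rowDefect (lookup v i)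
    row≤rowDefect i = begin
      ∑ k (λ j → weight adj i j * (u (lookup v i) * u (lookup v j)))
                                             ≤⟨ ∑-mono k (weight≤defect (toList-unique⁻ unique) realized i) ⟩
      ∑ k (defect (lookup v i) ∘ lookup v)   ≡⟨ ∑ᴸ-toList (defect (lookup v i)) v ⟨
      ∑ᴸ (defect (lookup v i)) (toList v)    ≤⟨ ∑ᴸ≤∑ (defect-nonNeg (lookup v i)) unique ⟩
      rowDefect (lookup v i)                 ∎

  ∑-rowDefect : ∑ t u ≡ 1ℚ → ∑ t rowDefect ≡ 1ℚ - 2ℚ * lagr ω u
  ∑-rowDefect ∑u≡1 = begin
    ∑ t rowDefect                                                       ≡⟨ ∑-cong t (λ a → ∑-- t _ _) ⟩
    ∑ t (λ a → ∑ t (λ b → u a * u b) - ∑ t (coupling a))                ≡⟨ ∑-- t _ _ ⟩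
    ∑ t (λ a → ∑ t (λ b → u a * u b)) - ∑ t (λ a → ∑ t (coupling a))    ≡⟨ cong₂ _-_ ∑∑uu≡1 ∑∑coupling≡2L ⟩
    1ℚ - (lagr ω u + lagr ω u)                                          ≡⟨ cong (_-_ 1ℚ) (solve 1 (λ L → L :+ L := con 2ℚ :* L)
                                                                                                refl (lagr ω u)) ⟩
    1ℚ - 2ℚ * lagr ω u                                                  ∎
    where
    open ≡-Reasoning
    ∑∑uu≡1 : ∑ t (λ a → ∑ t (λ b → u a * u b)) ≡ 1ℚ
    ∑∑uu≡1 = begin
      ∑ t (λ a → ∑ t (λ b → u a * u b))   ≡⟨ ∑-cong t (λ a → trans (∑-*ˡ t (u a) u) (cong (_*_ (u a)) ∑u≡1)) ⟩
      ∑ t (λ a → u a * 1ℚ)                ≡⟨ ∑-cong t (λ a → *-identityʳ (u a)) ⟩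
      ∑ t u                               ≡⟨ ∑u≡1 ⟩
      1ℚ                                  ∎
    ∑∑coupling≡2L : ∑ t (λ a → ∑ t (coupling a)) ≡ lagr ω u + lagr ω u
    ∑∑coupling≡2L = begin
      ∑ t (λ a → ∑ t (coupling a))                              ≡⟨ ∑-cong t (λ a → ∑-+ t _ _) ⟩
      ∑ t (λ a → ∑ t (pairTerm a) + ∑ t (λ b → pairTerm b a))   ≡⟨ ∑-+ t _ _ ⟩
      lagr ω u + ∑ t (λ a → ∑ t (λ b → pairTerm b a))           ≡⟨ cong (_+_ (lagr ω u)) (∑-swap t t (λ a b → pairTerm b a)) ⟩
      lagr ω u + lagr ω u                                       ∎

  ∑-slack : ∑ t u ≡ 1ℚ → ∀ θ → ∑ t (slack θ) ≡ 1ℚ - 2ℚ * lagr ω u - 2ℚ * θ + ι (+ t) * (θ * θ)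
  ∑-slack ∑u≡1 θ = begin
    ∑ t (slack θ)                                                    ≡⟨ ∑-+ t _ _ ⟩
    ∑ t (λ a → rowDefect a - 2ℚ * θ * u a) + ∑ t (λ _ → θ * θ)       ≡⟨ cong₂ _+_ (∑-- t _ _) (∑-const t (θ * θ)) ⟩
    ∑ t rowDefect - ∑ t (λ a → 2ℚ * θ * u a) + ι (+ t) * (θ * θ)     ≡⟨ cong (λ s → s + ι (+ t) * (θ * θ))
                                                                          (cong₂ _-_ (∑-rowDefect ∑u≡1) ∑2θu≡2θ) ⟩
    1ℚ - 2ℚ * lagr ω u - 2ℚ * θ + ι (+ t) * (θ * θ)                  ∎
    where
    open ≡-Reasoning
    ∑2θu≡2θ : ∑ t (λ a → 2ℚ * θ * u a) ≡ 2ℚ * θ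
    ∑2θu≡2θ = trans (∑-*ˡ t (2ℚ * θ) u) (trans (cong (_*_ (2ℚ * θ)) ∑u≡1) (*-identityʳ _))

  2*lagr≤ : ∑ t u ≡ 1ℚ → (P : Packing ω) → Unique (packingVertices ω P) →
                     ∀ θ → 2ℚ * lagr ω u ≤ 1ℚ - 2ℚ * θ + (ι (+ t) - packingWeight ω P) * (θ * θ)
  2*lagr≤ ∑u≡1 P unique θ = 0≤q-p⇒p≤q (subst (0ℚ ≤_) rearrange (p≤q⇒0≤q-p W*θ²≤∑slack))
    where
    W = packingWeight ω P
    copy-bound : CopyBound ω (slack θ) (θ * θ)
    copy-bound s realized unique-v = ≤-trans (shape-energy-bound s _ θ) (energy≤∑slack unique-v realized θ)
    W*θ²≤∑slack : W * (θ * θ) ≤ 1ℚ - 2ℚ * lagr ω u - 2ℚ * θ + ι (+ t) * (θ * θ)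
    W*θ²≤∑slack = subst (W * (θ * θ) ≤_) (∑-slack ∑u≡1 θ)
      (packing-bound ω (slack θ) (θ * θ) copy-bound (slack-nonNeg θ) P unique)
    rearrange : 1ℚ - 2ℚ * lagr ω u - 2ℚ * θ + ι (+ t) * (θ * θ) - W * (θ * θ)
              ≡ 1ℚ - 2ℚ * θ + (ι (+ t) - W) * (θ * θ) - 2ℚ * lagr ω u
    rearrange = solve 4 (λ L θ T W → con 1ℚ :- con 2ℚ :* L :- con 2ℚ :* θ :+ T :* (θ :* θ) :- W :* (θ :* θ)
                                  := con 1ℚ :- con 2ℚ :* θ :+ (T :- W) :* (θ :* θ) :- con 2ℚ :* L)
                        refl (lagr ω u) θ (ι (+ t)) W

-- Choice of θ

denom≡30*[t-weight] : ∀ t ℓ₁ ℓ₂ ℓ₃ ℓ₄ ℓ₅ ℓ₆ ℓ₇ →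
  denom t ℓ₁ ℓ₂ ℓ₃ ℓ₄ ℓ₅ ℓ₆ ℓ₇ ≡ (+ 30 / 1) * (ι (+ t) -
  (ι (+ ℓ₁) * density C₈ + (ι (+ ℓ₂) * density K₅ + (ι (+ ℓ₃) * density C₅ + (ι (+ ℓ₄) * density K₄ +
  (ι (+ ℓ₅) * density C₄ + (ι (+ ℓ₆) * density K₃ + (ι (+ ℓ₇) * density K₂ + 0ℚ))))))))
denom≡30*[t-weight] t ℓ₁ ℓ₂ ℓ₃ ℓ₄ ℓ₅ ℓ₆ ℓ₇ = trans
  (minus z₆ 20 ℓ₇ (minus z₅ 45 ℓ₆ (minus z₄ 60 ℓ₅ (minus z₃ 72 ℓ₄ (minus z₂ 75 ℓ₃ (minus z₁ 100 ℓ₂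
    (minus z₀ 120 ℓ₁ (trans (cong ι (ℤ.pos-* 30 t)) (ι-* (+ 30) (+ t))))))))))
  (solve 8 (λ T L₁ L₂ L₃ L₄ L₅ L₆ L₇ →
      con (ι (+ 30)) :* T :- con (ι (+ 120)) :* L₁ :- con (ι (+ 100)) :* L₂ :- con (ι (+ 75)) :* L₃
        :- con (ι (+ 72)) :* L₄ :- con (ι (+ 60)) :* L₅ :- con (ι (+ 45)) :* L₆ :- con (ι (+ 20)) :* L₇
    := con (+ 30 / 1) :* (T :- (L₁ :* con (density C₈) :+ (L₂ :* con (density K₅) :+ (L₃ :* con (density C₅)
        :+ (L₄ :* con (density K₄) :+ (L₅ :* con (density C₄) :+ (L₆ :* con (density K₃)
        :+ (L₇ :* con (density K₂) :+ con 0ℚ)))))))))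
    refl (ι (+ t)) (ι (+ ℓ₁)) (ι (+ ℓ₂)) (ι (+ ℓ₃)) (ι (+ ℓ₄)) (ι (+ ℓ₅)) (ι (+ ℓ₆)) (ι (+ ℓ₇)))
  where
  minus : ∀ z {q} k ℓ → ι z ≡ q → ι (z ℤ.- + (k ℕ.* ℓ)) ≡ q - ι (+ k) * ι (+ ℓ)
  minus z k ℓ ιz≡q =
    trans (ι-- z (+ (k ℕ.* ℓ))) (cong₂ _-_ ιz≡q (trans (cong ι (ℤ.pos-* k ℓ)) (ι-* (+ k) (+ ℓ))))
  z₀ z₁ z₂ z₃ z₄ z₅ z₆ : ℤ
  z₀ = + (30 ℕ.* t)
  z₁ = z₀ ℤ.- + (120 ℕ.* ℓ₁)
  z₂ = z₁ ℤ.- + (100 ℕ.* ℓ₂)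
  z₃ = z₂ ℤ.- + (75 ℕ.* ℓ₃)
  z₄ = z₃ ℤ.- + (72 ℕ.* ℓ₄)
  z₅ = z₄ ℤ.- + (60 ℕ.* ℓ₅)
  z₆ = z₅ ℤ.- + (45 ℕ.* ℓ₆)

1≤p⇒q≤⅔p⇒0<p-q : ∀ {p q} → 1ℚ ≤ p → q ≤ p * (+ 2 / 3) → 0ℚ < p - q
1≤p⇒q≤⅔p⇒0<p-q {p} {q} 1≤p q≤⅔p =
  subst₂ _<_ (+-identityʳ 0ℚ) (sym p-q≡) (+-mono-<-≤ (positive⁻¹ (+ 1 / 3)) rest≥0)
  where
  p-q≡ : p - q ≡ + 1 / 3 + ((p * (+ 2 / 3) - q) + (+ 1 / 3) * (p - 1ℚ))
  p-q≡ = solve 2 (λ p q → p :- q := con (+ 1 / 3) :+ ((p :* con (+ 2 / 3) :- q) :+ con (+ 1 / 3) :* (p :- con 1ℚ)))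
           refl p q
  rest≥0 : 0ℚ ≤ (p * (+ 2 / 3) - q) + (+ 1 / 3) * (p - 1ℚ)
  rest≥0 = +-mono-≤ (p≤q⇒0≤q-p q≤⅔p) (*-nonNeg (/-nonNeg 1 3) (p≤q⇒0≤q-p 1≤p))

÷-*-cancel : ∀ c {D N} .{{_ : NonZero D}} → D ≡ c * N → c ÷ D * N ≡ 1ℚ
÷-*-cancel c {D} {N} D≡cN = begin
  c * 1/ D * N         ≡⟨ solve 3 (λ c d N → c :* d :* N := d :* (c :* N)) refl c (1/ D) N ⟩
  1/ D * (c * N)       ≡⟨ cong (_*_ (1/ D)) D≡cN ⟨
  1/ D * D             ≡⟨ *-inverseˡ D ⟩
  1ℚ                   ∎
  where open ≡-Reasoning

completing-square : ∀ {θ N} → θ * N ≡ 1ℚ → 1ℚ - 2ℚ * θ + N * (θ * θ) ≡ 1ℚ - θ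
completing-square {θ} {N} θN≡1 = begin
  1ℚ - 2ℚ * θ + N * (θ * θ)       ≡⟨ solve 2 (λ θ N → con 1ℚ :- con 2ℚ :* θ :+ N :* (θ :* θ)
                                        := con 1ℚ :- con 2ℚ :* θ :+ (θ :* N) :* θ) refl θ N ⟩
  1ℚ - 2ℚ * θ + (θ * N) * θ       ≡⟨ cong (λ p → 1ℚ - 2ℚ * θ + p * θ) θN≡1 ⟩
  1ℚ - 2ℚ * θ + 1ℚ * θ            ≡⟨ solve 1 (λ θ → con 1ℚ :- con 2ℚ :* θ :+ con 1ℚ :* θ := con 1ℚ :- θ) refl θ ⟩
  1ℚ - θ                          ∎
  where open ≡-Reasoning

lemma4p2 : (t : ℕ) → 1 Data.Nat.≤ t → (ω : Fin t → Fin t → Weight) → Symmetric ω →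
    (ℓ₁ ℓ₂ ℓ₃ ℓ₄ ℓ₅ ℓ₆ ℓ₇ : ℕ) →
    (c8 : Vec (Vec (Fin t) 8) ℓ₁) → (k5 : Vec (Vec (Fin t) 5) ℓ₂) →
    (c5 : Vec (Vec (Fin t) 5) ℓ₃) → (k4 : Vec (Vec (Fin t) 4) ℓ₄) →
    (c4 : Vec (Vec (Fin t) 4) ℓ₅) → (k3 : Vec (Vec (Fin t) 3) ℓ₆) →
    (e2 : Vec (Vec (Fin t) 2) ℓ₇) →
    (∀ a → CycleHalf ω (lookup c8 a)) → (∀ a → CliqueHalf ω (lookup k5 a)) →
    (∀ a → CycleHalf ω (lookup c5 a)) → (∀ a → CliqueHalf ω (lookup k4 a)) →
    (∀ a → CycleHalf ω (lookup c4 a)) → (∀ a → CliqueHalf ω (lookup k3 a)) →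
    (∀ a → CliqueHalf ω (lookup e2 a)) →
    Unique (verts c8 ++ verts k5 ++ verts c5 ++ verts k4 ++ verts c4 ++ verts k3 ++ verts e2) →
    Σ (NonZero (denom t ℓ₁ ℓ₂ ℓ₃ ℓ₄ ℓ₅ ℓ₆ ℓ₇)) λ nz →
      (u : Fin t → ℚ) → InSimplex u →
        (+ 2 / 1) * lagr ω u ≤ 1ℚ - _÷_ (+ 30 / 1) (denom t ℓ₁ ℓ₂ ℓ₃ ℓ₄ ℓ₅ ℓ₆ ℓ₇) {{nz}}
lemma4p2 t 1≤t ω symω ℓ₁ ℓ₂ ℓ₃ ℓ₄ ℓ₅ ℓ₆ ℓ₇ c8 k5 c5 k4 c4 k3 e2 h₁ h₂ h₃ h₄ h₅ h₆ h₇ disjoint =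
  D≢0 , λ u (0≤u , ∑u≡1) → begin
    2ℚ * lagr ω u                 ≤⟨ Lagrangian.2*lagr≤ ω symω u 0≤u ∑u≡1 P disjointP θ ⟩
    1ℚ - 2ℚ * θ + N * (θ * θ)     ≡⟨ completing-square {θ} {N} (÷-*-cancel (+ 30 / 1) {D} {N} {{D≢0}} D≡30N) ⟩
    1ℚ - θ                        ∎
  where
  open ≤-Reasoning
  P : Packing ω
  P C₈ = family c8 (cycle-realizes symω ∘ h₁)
  P K₅ = family k5 (clique-realizes ∘ h₂)
  P C₅ = family c5 (cycle-realizes symω ∘ h₃)
  P K₄ = family k4 (clique-realizes ∘ h₄)
  P C₄ = family c4 (cycle-realizes symω ∘ h₅)
  P K₃ = family k3 (clique-realizes ∘ h₆)
  P K₂ = family e2 (clique-realizes ∘ h₇)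
  disjointP : Unique (packingVertices ω P)
  disjointP = subst Unique (cong (λ vs → verts c8 ++ verts k5 ++ verts c5 ++ verts k4 ++ verts c4 ++ verts k3 ++ vs)
                                 (sym (++-identityʳ (verts e2)))) disjoint
  D = denom t ℓ₁ ℓ₂ ℓ₃ ℓ₄ ℓ₅ ℓ₆ ℓ₇
  N = ι (+ t) - packingWeight ω P
  D≡30N : D ≡ (+ 30 / 1) * N
  D≡30N = denom≡30*[t-weight] t ℓ₁ ℓ₂ ℓ₃ ℓ₄ ℓ₅ ℓ₆ ℓ₇
  D≢0 : NonZero D
  D≢0 = pos⇒nonZero D {{subst Positive (sym D≡30N)
          (pos*pos⇒pos (+ 30 / 1) N {{positive (1≤p⇒q≤⅔p⇒0<p-q (1≤ι 1≤t) (packingWeight≤⅔t ω P disjointP))}})}}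
  θ = _÷_ (+ 30 / 1) D {{D≢0}}
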